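{- Let $C_0$ be a real constant and let $\mathcal{A}$ be a collection of pairwise non-parallel hyperplanes in $Q = S_1 \times \cdots \times S_n$ such that $\|F(A)\| > C_0$ for every $A \in \mathcal{A}$. Then for every integer $k$ with $1 \le k \le n$, \[ w_k(B_k) \le \frac{1}{(1-\delta_k)|S_k|} \sum_{\substack{J \subseteq \{1,\ldots,k-1\} \\ \|J\| > C_0/|S_k|}} \nu(J) = \frac{1}{(1-\delta_k)|S_k|} \sum_{\substack{J \subseteq \{1,\ldots,k-1\} \\ \|J\| > C_0/|S_k|}} \prod_{j \in J} \frac{1}{(1-\delta_j)|S_j|}. \]
   Context: Let $S_1, S_2, \ldots$ be finite sets, each of size at least $2$, fix a positive integer $n$, and write $Q_k = S_1 \times \cdots \times S_k$ for $k \ge 1$, $Q = Q_n$, and let $Q_0$ consist of the single empty tuple. A hyperplane is a set $A = Y_1 \times \cdots \times Y_n$ with $Y_j \subseteq S_j$ and $|Y_j| \in \{1, |S_j|\}$ for each $j$; its set of fixed coordinates is $F(A) = \{ j : |Y_j| = 1\}$; two hyperplanes $A, A'$ are parallel if $F(A) = F(A')$. For a collection $\mathcal{A}$ of hyperplanes let $\mathcal{A}_k = \{A \in \mathcal{A} : \max F(A) = k\}$ and $B_k = \bigcup_{A \in \mathcal{A}_k} A$, regarded as a subset of $Q_k$ (its projection onto the first $k$ coordinates). Fix numbers $\delta_j \in [0, 1/2]$. Weights are defined inductively: $w_0$ gives the empty tuple weight $1$. For $1 \le k \le n$ and $x \in Q_{k-1}$ let $\alpha_k(x) = |\{ y \in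 S_k : (x,y) \in B_k\}| / |S_k|$. If $\alpha_k(x) \le \delta_k$, set $w_k(x,y) = 0$ if $(x,y) \in B_k$ and $w_k(x,y) = \frac{1}{1-\alpha_k(x)} \cdot \frac{w_{k-1}(x)}{|S_k|}$ if $(x,y) \notin B_k$. If $\alpha_k(x) > \delta_k$, set $w_k(x,y) = \frac{\alpha_k(x) - \delta_k}{\alpha_k(x)(1-\delta_k)} \cdot \frac{w_{k-1}(x)}{|S_k|}$ if $(x,y) \in B_k$ and $w_k(x,y) = \frac{1}{1-\delta_k} \cdot \frac{w_{k-1}(x)}{|S_k|}$ if $(x,y) \notin B_k$. For $X \subseteq Q_k$, $w_k(X) = \sum_{x \in X} w_k(x)$. For $J \subseteq \{1,\ldots,n\}$, $\nu(J) = \prod_{j \in J} \frac{1}{(1-\delta_j)|S_j|}$ and $\|J\| = \prod_{j\in J} |S_j|$ (empty products equal $1$).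
   Formalization: The constant $C_0$ and the numbers $\delta_j \in [0, 1/2]$ are taken rational rather than real. -}

module Defs where

open import Data.Nat as ℕ using (ℕ; zero; suc; _∸_)
open import Data.Nat.Properties as ℕP using ()
open import Data.Bool using (Bool; true; false; _∧_; if_then_else_)
open import Data.Maybe using (Maybe; just; nothing)
open import Data.Fin using (Fin; toℕ)
open import Data.List using (List; []; _∷_; [_]; map; concatMap; foldr; filter; length; allFin)
open import Data.Bool.ListAction using (any)
open import Data.List.Relation.Unary.AllPairs using (AllPairs)
open import Data.Unit using (⊤; tt)
open import Data.Product using (_×_; _,_)
open import Data.Integer using (+_)
open import Data.Rational using (ℚ; 0ℚ; 1ℚ; _+_; _*_; _-_; _÷_; _≤ᵇ_; _<_; ≢-nonZero)
open import Data.Rational.Properties using (_≟_)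
open import Relation.Nullary using (yes; no; ¬_)
open import Relation.Binary.PropositionalEquality using (_≡_; refl)


⟦_⟧ : ℕ → ℚ
⟦ m ⟧ = Data.Rational._/_ (+ m) 1

-- total division (x / 0 := 0); only ever used with nonzero divisors below
_÷'_ : ℚ → ℚ → ℚ
p ÷' q with q ≟ 0ℚ
... | yes _ = 0ℚ
... | no q≢0 = _÷_ p q {{≢-nonZero q≢0}}

sumℚ : List ℚ → ℚ
sumℚ = foldr _+_ 0ℚ

-- The sets: S_j = Fin (s j) for j ≥ 1 (s 0 is irrelevant).
module _ (s : ℕ → ℕ) where

  Q : ℕ → Set
  Q zero = ⊤
  Q (suc k) = Q k × Fin (s (suc k))

  allQ : (k : ℕ) → List (Q k)
  allQ zero = [ tt ]
  allQ (suc k) = concatMap (λ x → map (λ y → (x , y)) (allFin (s (suc k)))) (allQ k)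

  -- hyperplanes Y_1 × ... × Y_k: coordinate j is `nothing` (Y_j = S_j)
  -- or `just a` (Y_j = {a})
  Hyp : ℕ → Set
  Hyp zero = ⊤
  Hyp (suc k) = Hyp k × Maybe (Fin (s (suc k)))

  Sub : ℕ → Set
  Sub zero = ⊤
  Sub (suc k) = Sub k × Bool

  allSub : (k : ℕ) → List (Sub k)
  allSub zero = [ tt ]
  allSub (suc k) = concatMap (λ J → (J , false) ∷ (J , true) ∷ []) (allSub k)

  F : {k : ℕ} → Hyp k → Sub k
  F {zero} tt = tt
  F {suc k} (A , nothing) = F A , false
  F {suc k} (A , just _) = F A , true

  ‖_‖ : {k : ℕ} → Sub k → ℕ
  ‖_‖ {zero} tt = 1
  ‖_‖ {suc k} (J , false) = ‖ J ‖
  ‖_‖ {suc k} (J , true) = ‖ J ‖ ℕ.* s (suc k)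

  Parallel : {k : ℕ} → Hyp k → Hyp k → Set
  Parallel A A' = F A ≡ F A'

  -- max F(A); the value 0 encodes F(A) = ∅ (coordinates start at 1)
  maxF : {k : ℕ} → Hyp k → ℕ
  maxF {zero} tt = 0
  maxF {suc k} (A , nothing) = maxF A
  maxF {suc k} (A , just _) = suc k

  projH : (k : ℕ) → {n : ℕ} → Hyp n → Maybe (Hyp k)
  projH k {n} A with n ℕ.≟ k
  ... | yes refl = just A
  projH k {zero} A | no _ = nothing
  projH k {suc n} (A , _) | no _ = projH k A

  memb : {k : ℕ} → Hyp k → Q k → Bool
  memb {zero} tt tt = true
  memb {suc k} (A , nothing) (x , y) = memb A x
  memb {suc k} (A , just a) (x , y) = (toℕ a ℕ.≡ᵇ toℕ y) ∧ memb A x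

  -- x ∈ B_k, where B_k = ⋃_{A ∈ 𝒜_k} A projected to Q_k
  inB : {n : ℕ} → List (Hyp n) → (k : ℕ) → Q k → Bool
  inB 𝒜 k x = any (λ A → (maxF A ℕ.≡ᵇ k) ∧ projMemb (projH k A)) 𝒜
    where
    projMemb : Maybe (Hyp k) → Bool
    projMemb nothing = false
    projMemb (just A') = memb A' x

  module _ (δ : ℕ → ℚ) {n : ℕ} (𝒜 : List (Hyp n)) where

    -- α_k(x) for x ∈ Q_{k-1}, written with k = suc m
    α : (m : ℕ) → Q m → ℚ
    α m x = ⟦ length (filter (λ y → inB 𝒜 (suc m) (x , y) Data.Bool.≟ true) (allFin (s (suc m)))) ⟧
              ÷' ⟦ s (suc m) ⟧

    w : (k : ℕ) → Q k → ℚ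
    w zero tt = 1ℚ
    w (suc m) (x , y) =
      let a = α m x
          d = δ (suc m)
          base = w m x ÷' ⟦ s (suc m) ⟧
          inb = inB 𝒜 (suc m) (x , y)
      in if a ≤ᵇ d
         then (if inb then 0ℚ else (1ℚ ÷' (1ℚ - a)) * base)
         else (if inb then ((a - d) ÷' (a * (1ℚ - d))) * base
                      else (1ℚ ÷' (1ℚ - d)) * base)

    wB : (k : ℕ) → ℚ
    wB k = sumℚ (map (λ x → if inB 𝒜 k x then w k x else 0ℚ) (allQ k))

  ν : (δ : ℕ → ℚ) → {k : ℕ} → Sub k → ℚ
  ν δ {zero} tt = 1ℚ
  ν δ {suc k} (J , false) = ν δ J
  ν δ {suc k} (J , true) = ν δ J * (1ℚ ÷' ((1ℚ - δ (suc k)) * ⟦ s (suc k) ⟧))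

-- The weights split w_{k-1}(x) over the fibre {x} × S_k without loss of mass, and no point of
-- the fibre receives more than w_{k-1}(x) / ((1 - δ_k) |S_k|). By induction on k, a hyperplane H
-- of Q_k therefore has weight at most ν(F(H)): free coordinates preserve weight and each fixed
-- coordinate j costs a factor 1 / ((1 - δ_j) |S_j|). Every A ∈ 𝒜_k projects onto Q_k as H × {a}
-- with H a hyperplane of Q_{k-1}, so w_k(B_k) ≤ Σ_A ν(F(H)) / ((1 - δ_k) |S_k|). Non-parallel
-- hyperplanes give distinct sets F(H) ⊆ {1, …, k-1}, and ‖F(H)‖ |S_k| = ‖F(A)‖ > C₀.

module Submission where

open import Defs
open import Data.Nat using (ℕ; zero; suc; _∸_; s≤s; z≤n) renaming (_≤_ to _≤ℕ_; _*_ to _*ℕ_)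
import Data.Nat as ℕ
import Data.Nat.Properties as ℕ
import Data.Nat.Coprimality as Coprime
open import Data.Bool using (Bool; true; false; if_then_else_; _∧_; _∨_; T)
open import Data.Bool.Properties using (∨-identityʳ)
import Data.Bool as Bool
open import Data.Fin using (Fin; toℕ) renaming (zero to fzero; suc to fsuc)
import Data.Integer as ℤ
import Data.Integer.Properties as ℤ
open import Data.List using (List; []; _∷_; _++_; [_]; map; filter; length; concatMap; tabulate; allFin; mapMaybe)
open import Data.List.Properties using (map-++; map-∘; map-cong; map-tabulate; length-tabulate)
open import Data.List.Membership.Propositional using (_∈_)
open import Data.List.Membership.Propositional.Properties using (∈-∃++; ∈-++⁻; ∈-++⁺ˡ; ∈-++⁺ʳ; ∈-filter⁺; ∈-concatMap⁺)
open import Data.List.Relation.Unary.Any as Any using (here; there)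
import Data.List.Relation.Unary.All as All
open import Data.List.Relation.Unary.AllPairs as AllPairs using (AllPairs; []; _∷_)
open import Data.List.Relation.Unary.Unique.Propositional using (Unique)
open import Data.List.Relation.Binary.Subset.Propositional using (_⊆_)
open import Data.List.Relation.Binary.Permutation.Propositional using (_↭_; ↭⇒↭ₛ)
open import Data.List.Relation.Binary.Permutation.Propositional.Properties using (shift; map⁺)
import Data.List.Relation.Binary.Permutation.Setoid.Properties as Permutationₛ
open import Data.Maybe using (Maybe; just; nothing; maybe′)
open import Data.Product using (_×_; _,_; proj₁; proj₂; ∃-syntax)
open import Data.Sum using (inj₁; inj₂)
open import Data.Unit using (tt)
open import Data.Empty using (⊥-elim)
open import Data.Rational using (ℚ; 0ℚ; 1ℚ; ½; _<_; _≤_; _*_; _-_; _+_; -_; _<?_; _≤?_; _≤ᵇ_; 1/_; ≢-nonZero; mkℚ; Positive; nonNegative; positive)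
open import Data.Rational.Properties
open import Data.Rational.Solver using (module +-*-Solver)
open +-*-Solver using (solve; _:+_; _:*_; _:-_; _:=_; con)
open import Algebra.Bundles using (CommutativeMonoid)
open import Function using (id)
open import Relation.Nullary using (¬_; yes; no)
open import Relation.Nullary.Decidable using (toWitness)
open import Relation.Binary.PropositionalEquality hiding ([_])

private
  variable
    X Y : Set
    p q r : ℚ

-- Rational arithmetic

0≤1 : 0ℚ ≤ 1ℚ
0≤1 = toWitness {a? = 0ℚ ≤? 1ℚ} tt

½<1 : ½ < 1ℚ
½<1 = toWitness {a? = ½ <? 1ℚ} tt

p<q⇒0<q-p : p < q → 0ℚ < q - p
p<q⇒0<q-p {p} {q} p<q = subst (_< q - p) (+-inverseʳ p) (+-monoˡ-< (- p) p<q)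

p≤q⇒0≤q-p : p ≤ q → 0ℚ ≤ q - p
p≤q⇒0≤q-p {p} {q} p≤q = subst (_≤ q - p) (+-inverseʳ p) (+-monoˡ-≤ (- p) p≤q)

pos⇒≢0 : 0ℚ < p → p ≢ 0ℚ
pos⇒≢0 0<p p≡0 = <-irrefl (sym p≡0) 0<p

*-nonNeg : 0ℚ ≤ p → 0ℚ ≤ q → 0ℚ ≤ p * q
*-nonNeg {p} {q} 0≤p 0≤q = nonNegative⁻¹ _ {{nonNeg*nonNeg⇒nonNeg p {{nonNegative 0≤p}} q {{nonNegative 0≤q}}}}

*-pos : 0ℚ < p → 0ℚ < q → 0ℚ < p * q
*-pos {p} {q} 0<p 0<q = positive⁻¹ _ {{pos*pos⇒pos p {{positive 0<p}} q {{positive 0<q}}}}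

*-cancelʳ-≡-pos : 0ℚ < r → p * r ≡ q * r → p ≡ q
*-cancelʳ-≡-pos {r} {p} {q} 0<r pr≡qr = begin
  p                ≡⟨ *-identityʳ p ⟨
  p * 1ℚ           ≡⟨ cong (p *_) (*-inverseʳ r) ⟨
  p * (r * 1/ r)   ≡⟨ *-assoc p r _ ⟨
  (p * r) * 1/ r   ≡⟨ cong (_* 1/ r) pr≡qr ⟩
  (q * r) * 1/ r   ≡⟨ *-assoc q r _ ⟩
  q * (r * 1/ r)   ≡⟨ cong (q *_) (*-inverseʳ r) ⟩
  q * 1ℚ           ≡⟨ *-identityʳ q ⟩
  q                ∎
  where
  open ≡-Reasoning
  instance _ = ≢-nonZero (pos⇒≢0 0<r)

÷'-*-cancel : 0ℚ < q → (p ÷' q) * q ≡ p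
÷'-*-cancel {q} {p} 0<q with q ≟ 0ℚ
... | yes q≡0 = ⊥-elim (pos⇒≢0 0<q q≡0)
... | no q≢0  = trans (*-assoc p _ q) (trans (cong (p *_) (*-inverseˡ q {{≢-nonZero q≢0}})) (*-identityʳ p))

÷'-nonNeg : 0ℚ ≤ p → 0ℚ ≤ q → 0ℚ ≤ p ÷' q
÷'-nonNeg {p} {q} 0≤p 0≤q with q ≟ 0ℚ
... | yes _   = ≤-refl
... | no q≢0  = *-nonNeg 0≤p (nonNegative⁻¹ 1/q {{pos⇒nonNeg 1/q {{1/pos⇒pos q {{q-pos}}}}}})
  where
  1/q = (1/ q) {{≢-nonZero q≢0}}
  q-pos : Positive q
  q-pos = nonNeg∧nonZero⇒pos q {{nonNegative 0≤q}} {{≢-nonZero q≢0}}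

⟦⟧-nonNeg : ∀ m → 0ℚ ≤ ⟦ m ⟧
⟦⟧-nonNeg m = nonNegative⁻¹ _ {{normalize-nonNeg m 1}}

⟦⟧-pos : ∀ {m} → 0 ℕ.< m → 0ℚ < ⟦ m ⟧
⟦⟧-pos {suc m} _ = positive⁻¹ _ {{normalize-pos (suc m) 1}}

-- 1ℚ + ⟦ m ⟧ unfolds to the normalisation of (1 * 1 + m * 1) / 1, with ⟦ m ⟧ read as mkℚ (+ m) 0 _.
⟦suc⟧ : ∀ m → ⟦ suc m ⟧ ≡ 1ℚ + ⟦ m ⟧
⟦suc⟧ m = trans (cong (Data.Rational._/ 1) (cong (ℤ._+_ (ℤ.+ 1)) (sym (ℤ.*-identityʳ (ℤ.+ m)))))
                (cong (1ℚ +_) (sym (↥p/↧p≡p (mkℚ (ℤ.+ m) 0 (Coprime.sym (Coprime.1-coprimeTo m))))))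

-- Finite sums

sumℚ-++ : (xs ys : List ℚ) → sumℚ (xs ++ ys) ≡ sumℚ xs + sumℚ ys
sumℚ-++ []       ys = sym (+-identityˡ _)
sumℚ-++ (x ∷ xs) ys = trans (cong (x +_) (sumℚ-++ xs ys)) (sym (+-assoc x _ _))

sumℚ-↭ : {xs ys : List ℚ} → xs ↭ ys → sumℚ xs ≡ sumℚ ys
sumℚ-↭ xs↭ys = Permutationₛ.foldr-commMonoid ℚ-+.setoid ℚ-+.isCommutativeMonoid (↭⇒↭ₛ xs↭ys)
  where module ℚ-+ = CommutativeMonoid +-0-commutativeMonoid

sumℚ-concatMap : (f : Y → ℚ) (g : X → List Y) (xs : List X) →
                 sumℚ (map f (concatMap g xs)) ≡ sumℚ (map (λ x → sumℚ (map f (g x))) xs)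
sumℚ-concatMap f g []       = refl
sumℚ-concatMap f g (x ∷ xs) = begin
  sumℚ (map f (g x ++ concatMap g xs))                ≡⟨ cong sumℚ (map-++ f (g x) _) ⟩
  sumℚ (map f (g x) ++ map f (concatMap g xs))         ≡⟨ sumℚ-++ (map f (g x)) _ ⟩
  sumℚ (map f (g x)) + sumℚ (map f (concatMap g xs))   ≡⟨ cong (sumℚ (map f (g x)) +_) (sumℚ-concatMap f g xs) ⟩
  sumℚ (map f (g x)) + sumℚ (map (λ x → sumℚ (map f (g x))) xs) ∎
  where open ≡-Reasoning

sumℚ-mono : {f g : X → ℚ} (xs : List X) → (∀ x → f x ≤ g x) → sumℚ (map f xs) ≤ sumℚ (map g xs)
sumℚ-mono []       f≤g = ≤-refl
sumℚ-mono (x ∷ xs) f≤g = +-mono-≤ (f≤g x) (sumℚ-mono xs f≤g)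

sumℚ-map-0 : (xs : List X) → sumℚ (map (λ _ → 0ℚ) xs) ≡ 0ℚ
sumℚ-map-0 []       = refl
sumℚ-map-0 (x ∷ xs) = trans (+-identityˡ _) (sumℚ-map-0 xs)

sumℚ-nonNeg : {f : X → ℚ} (xs : List X) → (∀ x → 0ℚ ≤ f x) → 0ℚ ≤ sumℚ (map f xs)
sumℚ-nonNeg xs 0≤f = ≤-trans (≤-reflexive (sym (sumℚ-map-0 xs))) (sumℚ-mono xs 0≤f)

*-distribˡ-sumℚ : (c : ℚ) (f : X → ℚ) (xs : List X) → c * sumℚ (map f xs) ≡ sumℚ (map (λ x → c * f x) xs)
*-distribˡ-sumℚ c f []       = *-zeroʳ c
*-distribˡ-sumℚ c f (x ∷ xs) = trans (*-distribˡ-+ c (f x) _) (cong (c * f x +_) (*-distribˡ-sumℚ c f xs))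

sumℚ-+ : (f g : X → ℚ) (xs : List X) → sumℚ (map (λ x → f x + g x) xs) ≡ sumℚ (map f xs) + sumℚ (map g xs)
sumℚ-+ f g []       = sym (+-identityˡ 0ℚ)
sumℚ-+ f g (x ∷ xs) = trans (cong (f x + g x +_) (sumℚ-+ f g xs))
  (solve 4 (λ a b c d → (a :+ b) :+ (c :+ d) := (a :+ c) :+ (b :+ d)) refl (f x) (g x) _ _)

sumℚ-comm : (h : X → Y → ℚ) (xs : List X) (ys : List Y) →
            sumℚ (map (λ x → sumℚ (map (h x) ys)) xs) ≡ sumℚ (map (λ y → sumℚ (map (λ x → h x y) xs)) ys)
sumℚ-comm h []       ys = sym (sumℚ-map-0 ys)
sumℚ-comm h (x ∷ xs) ys = trans (cong (sumℚ (map (h x) ys) +_) (sumℚ-comm h xs ys))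
                                (sym (sumℚ-+ (h x) (λ y → sumℚ (map (λ x → h x y) xs)) ys))

sumℚ-mono-⊆ : {f : X → ℚ} → (∀ x → 0ℚ ≤ f x) → {xs ys : List X} →
              Unique xs → xs ⊆ ys → sumℚ (map f xs) ≤ sumℚ (map f ys)
sumℚ-mono-⊆ 0≤f {[]}     {ys} _ _ = sumℚ-nonNeg ys 0≤f
sumℚ-mono-⊆ {f = f} 0≤f {x ∷ xs} {ys} (x∉xs ∷ xs-unique) x∷xs⊆ys
  with ys₁ , ys₂ , refl ← ∈-∃++ (x∷xs⊆ys (here refl)) = begin
  f x + sumℚ (map f xs)           ≤⟨ +-monoʳ-≤ (f x) (sumℚ-mono-⊆ 0≤f xs-unique xs⊆ys₁++ys₂) ⟩
  f x + sumℚ (map f (ys₁ ++ ys₂)) ≡⟨ sumℚ-↭ (map⁺ f (shift x ys₁ ys₂)) ⟨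
  sumℚ (map f (ys₁ ++ x ∷ ys₂))   ∎
  where
  open ≤-Reasoning
  xs⊆ys₁++ys₂ : xs ⊆ ys₁ ++ ys₂
  xs⊆ys₁++ys₂ z∈xs with ∈-++⁻ ys₁ (x∷xs⊆ys (there z∈xs))
  ... | inj₁ z∈ys₁         = ∈-++⁺ˡ z∈ys₁
  ... | inj₂ (here refl)   = ⊥-elim (All.lookup x∉xs z∈xs refl)
  ... | inj₂ (there z∈ys₂) = ∈-++⁺ʳ ys₁ z∈ys₂

sumℚ-maybe′ : (f : Y → ℚ) (g : X → Maybe Y) (xs : List X) →
              sumℚ (map (λ x → maybe′ f 0ℚ (g x)) xs) ≡ sumℚ (map f (mapMaybe g xs))
sumℚ-maybe′ f g []       = refl
sumℚ-maybe′ f g (x ∷ xs) with g x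
... | just y  = cong (f y +_) (sumℚ-maybe′ f g xs)
... | nothing = trans (+-identityˡ _) (sumℚ-maybe′ f g xs)

∈-mapMaybe⁻ : (g : X → Maybe Y) {xs : List X} {y : Y} → y ∈ mapMaybe g xs → ∃[ x ] x ∈ xs × g x ≡ just y
∈-mapMaybe⁻ g {x ∷ xs} y∈ with g x in gx | y∈
... | nothing | y∈′         = let x′ , x′∈ , e = ∈-mapMaybe⁻ g y∈′ in x′ , there x′∈ , e
... | just _  | here refl   = x , here refl , gx
... | just _  | there y∈′   = let x′ , x′∈ , e = ∈-mapMaybe⁻ g y∈′ in x′ , there x′∈ , e

Unique-mapMaybe : (g : X → Maybe Y) {xs : List X} →
                  AllPairs (λ x x′ → ∀ {y} → g x ≡ just y → g x′ ≢ just y) xs → Unique (mapMaybe g xs)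
Unique-mapMaybe g []                 = []
Unique-mapMaybe g {x ∷ xs} (r ∷ rs) with g x
... | nothing = Unique-mapMaybe g rs
... | just y  = All.tabulate y≢ ∷ Unique-mapMaybe g rs
  where
  y≢ : ∀ {y′} → y′ ∈ mapMaybe g xs → y ≢ y′
  y≢ y′∈ refl = let x′ , x′∈xs , gx′ = ∈-mapMaybe⁻ g y′∈ in All.lookup r x′∈xs refl gx′

countTrue : (X → Bool) → List X → ℕ
countTrue b xs = length (filter (λ x → b x Bool.≟ true) xs)

sumℚ-map-Bool : (f : Bool → ℚ) (b : X → Bool) (xs : List X) →
                sumℚ (map (λ x → f (b x)) xs)
                  ≡ ⟦ countTrue b xs ⟧ * f true + (⟦ length xs ⟧ - ⟦ countTrue b xs ⟧) * f false
sumℚ-map-Bool f b []       = solve 2 (λ t u → con 0ℚ := con 0ℚ :* t :+ (con 0ℚ :- con 0ℚ) :* u) refl (f true) (f false)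
sumℚ-map-Bool f b (x ∷ xs) with b x
... | true  = begin
  f true + sumℚ (map (λ x → f (b x)) xs)           ≡⟨ cong (f true +_) (sumℚ-map-Bool f b xs) ⟩
  f true + (⟦ c ⟧ * f true + (⟦ l ⟧ - ⟦ c ⟧) * f false)
    ≡⟨ solve 4 (λ t u c l → t :+ (c :* t :+ (l :- c) :* u) := (con 1ℚ :+ c) :* t :+ ((con 1ℚ :+ l) :- (con 1ℚ :+ c)) :* u)
             refl (f true) (f false) ⟦ c ⟧ ⟦ l ⟧ ⟩
  (1ℚ + ⟦ c ⟧) * f true + ((1ℚ + ⟦ l ⟧) - (1ℚ + ⟦ c ⟧)) * f false
    ≡⟨ cong₂ (λ c′ l′ → c′ * f true + (l′ - c′) * f false) (⟦suc⟧ c) (⟦suc⟧ l) ⟨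
  ⟦ suc c ⟧ * f true + (⟦ suc l ⟧ - ⟦ suc c ⟧) * f false ∎
  where
  open ≡-Reasoning
  c = countTrue b xs
  l = length xs
... | false = begin
  f false + sumℚ (map (λ x → f (b x)) xs)          ≡⟨ cong (f false +_) (sumℚ-map-Bool f b xs) ⟩
  f false + (⟦ c ⟧ * f true + (⟦ l ⟧ - ⟦ c ⟧) * f false)
    ≡⟨ solve 4 (λ t u c l → u :+ (c :* t :+ (l :- c) :* u) := c :* t :+ ((con 1ℚ :+ l) :- c) :* u)
             refl (f true) (f false) ⟦ c ⟧ ⟦ l ⟧ ⟩
  ⟦ c ⟧ * f true + ((1ℚ + ⟦ l ⟧) - ⟦ c ⟧) * f false
    ≡⟨ cong (λ l′ → ⟦ c ⟧ * f true + (l′ - ⟦ c ⟧) * f false) (⟦suc⟧ l) ⟨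
  ⟦ c ⟧ * f true + (⟦ suc l ⟧ - ⟦ c ⟧) * f false ∎
  where
  open ≡-Reasoning
  c = countTrue b xs
  l = length xs

sumℚ-indicator-allFin : ∀ {N} (a : Fin N) (v : ℚ) →
                        sumℚ (map (λ y → if toℕ a ℕ.≡ᵇ toℕ y then v else 0ℚ) (allFin N)) ≡ v
sumℚ-indicator-allFin {N} a v = trans (cong sumℚ (map-tabulate {n = N} id _)) (on-tabulate a)
  where
  tabulate-0 : ∀ M → sumℚ (tabulate {n = M} (λ _ → 0ℚ)) ≡ 0ℚ
  tabulate-0 zero    = refl
  tabulate-0 (suc M) = trans (+-identityˡ _) (tabulate-0 M)
  on-tabulate : ∀ {M} (a : Fin M) → sumℚ (tabulate {n = M} (λ y → if toℕ a ℕ.≡ᵇ toℕ y then v else 0ℚ)) ≡ v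
  on-tabulate {suc M} fzero    = trans (cong (v +_) (tabulate-0 M)) (+-identityʳ v)
  on-tabulate {suc M} (fsuc a) = trans (+-identityˡ _) (on-tabulate a)

-- Splitting the weight of a fibre

-- w_k(x , y) = splitFactor α_k(x) δ_k [(x , y) ∈ B_k] * w_{k-1}(x) / |S_k|
splitFactor : (a d : ℚ) → Bool → ℚ
splitFactor a d b =
  if a ≤ᵇ d then (if b then 0ℚ else 1ℚ ÷' (1ℚ - a))
            else (if b then (a - d) ÷' (a * (1ℚ - d)) else 1ℚ ÷' (1ℚ - d))

module _ {a d : ℚ} (0≤d : 0ℚ ≤ d) (d<1 : d < 1ℚ) where

  private
    0<1-d : 0ℚ < 1ℚ - d
    0<1-d = p<q⇒0<q-p d<1

    0<1-a : a ≤ d → 0ℚ < 1ℚ - a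
    0<1-a a≤d = p<q⇒0<q-p (≤-<-trans a≤d d<1)

    0<a : d < a → 0ℚ < a
    0<a d<a = ≤-<-trans 0≤d d<a

    ≤ᵇ-true : (a ≤ᵇ d) ≡ true → a ≤ d
    ≤ᵇ-true eq = ≤ᵇ⇒≤ (subst T (sym eq) tt)

    ≤ᵇ-false : (a ≤ᵇ d) ≡ false → d < a
    ≤ᵇ-false eq = ≰⇒> (λ a≤d → subst T eq (≤⇒≤ᵇ a≤d))

  splitFactor-nonNeg : ∀ b → 0ℚ ≤ splitFactor a d b
  splitFactor-nonNeg b with a ≤ᵇ d in eq | b
  ... | true  | true  = ≤-refl
  ... | true  | false = ÷'-nonNeg 0≤1 (<⇒≤ (0<1-a (≤ᵇ-true eq)))
  ... | false | true  = ÷'-nonNeg (<⇒≤ (p<q⇒0<q-p d<a)) (<⇒≤ (*-pos (0<a d<a) 0<1-d))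
    where d<a = ≤ᵇ-false eq
  ... | false | false = ÷'-nonNeg 0≤1 (<⇒≤ 0<1-d)

  splitFactor-bound : ∀ b → splitFactor a d b * (1ℚ - d) ≤ 1ℚ
  splitFactor-bound b with a ≤ᵇ d in eq | b
  ... | true  | true  = ≤-trans (≤-reflexive (*-zeroˡ (1ℚ - d))) 0≤1
  ... | true  | false = begin
    u * (1ℚ - d) ≤⟨ *-monoˡ-≤-nonNeg u {{nonNegative (÷'-nonNeg 0≤1 (<⇒≤ 0<1-a′))}}
                                         (+-monoʳ-≤ 1ℚ (neg-antimono-≤ (≤ᵇ-true eq))) ⟩
    u * (1ℚ - a) ≡⟨ ÷'-*-cancel 0<1-a′ ⟩
    1ℚ           ∎
    where
    open ≤-Reasoning
    u = 1ℚ ÷' (1ℚ - a)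
    0<1-a′ = 0<1-a (≤ᵇ-true eq)
  ... | false | true  = *-cancelʳ-≤-pos a {{positive 0<a′}} (begin
    (v * (1ℚ - d)) * a ≡⟨ solve 3 (λ v e a → (v :* e) :* a := v :* (a :* e)) refl v (1ℚ - d) a ⟩
    v * (a * (1ℚ - d)) ≡⟨ ÷'-*-cancel (*-pos 0<a′ 0<1-d) ⟩
    a - d              ≤⟨ +-monoʳ-≤ a (neg-antimono-≤ 0≤d) ⟩
    a - 0ℚ             ≡⟨ solve 1 (λ a → a :- con 0ℚ := con 1ℚ :* a) refl a ⟩
    1ℚ * a             ∎)
    where
    open ≤-Reasoning
    v = (a - d) ÷' (a * (1ℚ - d))
    0<a′ = 0<a (≤ᵇ-false eq)
  ... | false | false = ≤-reflexive (÷'-*-cancel 0<1-d)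

  splitFactor-mean : a * splitFactor a d true + (1ℚ - a) * splitFactor a d false ≡ 1ℚ
  splitFactor-mean with a ≤ᵇ d in eq
  ... | true  = begin
    a * 0ℚ + (1ℚ - a) * u ≡⟨ solve 3 (λ a e u → a :* con 0ℚ :+ e :* u := u :* e) refl a (1ℚ - a) u ⟩
    u * (1ℚ - a)          ≡⟨ ÷'-*-cancel (0<1-a (≤ᵇ-true eq)) ⟩
    1ℚ                    ∎
    where
    open ≡-Reasoning
    u = 1ℚ ÷' (1ℚ - a)
  ... | false = *-cancelʳ-≡-pos 0<1-d (begin
    (a * v + (1ℚ - a) * t) * (1ℚ - d)
      ≡⟨ solve 4 (λ a v t e → (a :* v :+ (con 1ℚ :- a) :* t) :* e := v :* (a :* e) :+ (con 1ℚ :- a) :* (t :* e))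
               refl a v t (1ℚ - d) ⟩
    v * (a * (1ℚ - d)) + (1ℚ - a) * (t * (1ℚ - d))
      ≡⟨ cong₂ (λ x y → x + (1ℚ - a) * y) (÷'-*-cancel (*-pos (0<a (≤ᵇ-false eq)) 0<1-d)) (÷'-*-cancel 0<1-d) ⟩
    (a - d) + (1ℚ - a) * 1ℚ
      ≡⟨ solve 2 (λ a d → (a :- d) :+ (con 1ℚ :- a) :* con 1ℚ := con 1ℚ :* (con 1ℚ :- d)) refl a d ⟩
    1ℚ * (1ℚ - d) ∎)
    where
    open ≡-Reasoning
    v = (a - d) ÷' (a * (1ℚ - d))
    t = 1ℚ ÷' (1ℚ - d)

module _ {d N W : ℚ} (0≤d : 0ℚ ≤ d) (d<1 : d < 1ℚ) (0<N : 0ℚ < N) where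

  splitFactor-step : ∀ a b → 0ℚ ≤ W → splitFactor a d b * (W ÷' N) ≤ (1ℚ ÷' ((1ℚ - d) * N)) * W
  splitFactor-step a b 0≤W = *-cancelʳ-≤-pos D {{positive 0<D}} (begin
    (f * (W ÷' N)) * D         ≡⟨ solve 4 (λ f b e N → (f :* b) :* (e :* N) := (f :* e) :* (b :* N)) refl f (W ÷' N) (1ℚ - d) N ⟩
    (f * (1ℚ - d)) * ((W ÷' N) * N) ≡⟨ cong ((f * (1ℚ - d)) *_) (÷'-*-cancel 0<N) ⟩
    (f * (1ℚ - d)) * W         ≤⟨ *-monoʳ-≤-nonNeg W {{nonNegative 0≤W}} (splitFactor-bound {a = a} 0≤d d<1 b) ⟩
    1ℚ * W                     ≡⟨ cong (_* W) (÷'-*-cancel 0<D) ⟨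
    ((1ℚ ÷' D) * D) * W        ≡⟨ solve 3 (λ c D W → (c :* D) :* W := (c :* W) :* D) refl (1ℚ ÷' D) D W ⟩
    ((1ℚ ÷' D) * W) * D        ∎)
    where
    open ≤-Reasoning
    f = splitFactor a d b
    D = (1ℚ - d) * N
    0<D = *-pos (p<q⇒0<q-p d<1) 0<N

  splitFactor-sum : (b : X → Bool) (ys : List X) → ⟦ length ys ⟧ ≡ N →
    sumℚ (map (λ y → splitFactor (⟦ countTrue b ys ⟧ ÷' N) d (b y) * (W ÷' N)) ys) ≡ W
  splitFactor-sum b ys |ys|≡N = begin
    sumℚ (map (λ y → f (b y) * (W ÷' N)) ys)        ≡⟨ cong sumℚ (map-cong (λ y → *-comm (f (b y)) (W ÷' N)) ys) ⟩
    sumℚ (map (λ y → (W ÷' N) * f (b y)) ys)        ≡⟨ *-distribˡ-sumℚ (W ÷' N) (λ y → f (b y)) ys ⟨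
    (W ÷' N) * sumℚ (map (λ y → f (b y)) ys)        ≡⟨ cong ((W ÷' N) *_) (sumℚ-map-Bool f b ys) ⟩
    (W ÷' N) * (⟦ c ⟧ * f true + (⟦ length ys ⟧ - ⟦ c ⟧) * f false)
      ≡⟨ cong₂ (λ c′ l′ → (W ÷' N) * (c′ * f true + (l′ - c′) * f false)) (sym (÷'-*-cancel 0<N)) |ys|≡N ⟩
    (W ÷' N) * ((a * N) * f true + (N - a * N) * f false)
      ≡⟨ solve 5 (λ w a N t u → w :* ((a :* N) :* t :+ (N :- a :* N) :* u) := (w :* N) :* (a :* t :+ (con 1ℚ :- a) :* u))
               refl (W ÷' N) a N (f true) (f false) ⟩
    ((W ÷' N) * N) * (a * f true + (1ℚ - a) * f false)
      ≡⟨ cong₂ _*_ (÷'-*-cancel 0<N) (splitFactor-mean {a = a} 0≤d d<1) ⟩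
    W * 1ℚ                                          ≡⟨ *-identityʳ W ⟩
    W                                               ∎
    where
    open ≡-Reasoning
    c = countTrue b ys
    a = ⟦ c ⟧ ÷' N
    f = splitFactor a d

-- Hyperplanes

module _ (s : ℕ → ℕ) where

  maxF≤ : ∀ {m} (H : Hyp s m) → maxF s H ≤ℕ m
  maxF≤ {zero}  tt           = z≤n
  maxF≤ {suc m} (H , nothing) = ℕ.m≤n⇒m≤1+n (maxF≤ H)
  maxF≤ {suc m} (H , just _)  = ℕ.≤-refl

  maxF-projH : ∀ k {n} (A : Hyp s n) {H} → projH s k A ≡ just H → maxF s A ≡ k → maxF s H ≡ k
  maxF-projH k {n} A eq max≡k with n ℕ.≟ k
  maxF-projH k {n}     A            refl max≡k | yes refl = max≡k
  maxF-projH k {zero}  A            ()   max≡k | no _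
  maxF-projH k {suc n} (A , nothing) eq  max≡k | no _    = maxF-projH k A eq max≡k
  maxF-projH k {suc n} (A , just _)  eq  max≡k | no n≢k  = ⊥-elim (n≢k max≡k)

  ‖F‖-projH : ∀ k {n} (A : Hyp s n) {H} → projH s k A ≡ just H → maxF s A ≡ k → ‖_‖ s (F s A) ≡ ‖_‖ s (F s H)
  ‖F‖-projH k {n} A eq max≡k with n ℕ.≟ k
  ‖F‖-projH k {n}     A            refl max≡k | yes refl = refl
  ‖F‖-projH k {zero}  A            ()   max≡k | no _
  ‖F‖-projH k {suc n} (A , nothing) eq  max≡k | no _    = ‖F‖-projH k A eq max≡k
  ‖F‖-projH k {suc n} (A , just _)  eq  max≡k | no n≢k  = ⊥-elim (n≢k max≡k)

  Parallel-projH : ∀ k {n} (A₁ A₂ : Hyp s n) {H₁ H₂} → projH s k A₁ ≡ just H₁ → projH s k A₂ ≡ just H₂ →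
                   maxF s A₁ ≡ k → maxF s A₂ ≡ k → Parallel s H₁ H₂ → Parallel s A₁ A₂
  Parallel-projH k {n} A₁ A₂ eq₁ eq₂ max₁ max₂ par with n ℕ.≟ k
  Parallel-projH k {n}     A₁ A₂ refl refl max₁ max₂ par | yes refl = par
  Parallel-projH k {zero}  A₁ A₂ () eq₂ max₁ max₂ par | no _
  Parallel-projH k {suc n} (A₁ , nothing) (A₂ , nothing) eq₁ eq₂ max₁ max₂ par | no _ =
    cong (_, false) (Parallel-projH k A₁ A₂ eq₁ eq₂ max₁ max₂ par)
  Parallel-projH k {suc n} (A₁ , just _)  A₂             eq₁ eq₂ max₁ max₂ par | no n≢k = ⊥-elim (n≢k max₁)
  Parallel-projH k {suc n} (A₁ , nothing) (A₂ , just _)  eq₁ eq₂ max₁ max₂ par | no n≢k = ⊥-elim (n≢k max₂)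

  -- A ∈ 𝒜_{m+1} projects onto Q_{m+1} as H × {a} with H a hyperplane of Q_m; its key is F(H).
  topKey : ∀ {m} → Maybe (Hyp s (suc m)) → Maybe (Sub s m)
  topKey (just (H , just _)) = just (F s H)
  topKey _                   = nothing

  levelKey : ∀ {n} m → Hyp s n → Maybe (Sub s m)
  levelKey m A = if maxF s A ℕ.≡ᵇ suc m then topKey (projH s (suc m) A) else nothing

  allSub-complete : ∀ m (J : Sub s m) → J ∈ allSub s m
  allSub-complete zero    tt      = here refl
  allSub-complete (suc m) (J , b) = ∈-concatMap⁺ _ (Any.map (λ { refl → pair b }) (allSub-complete m J))
    where
    pair : ∀ b → (J , b) ∈ (J , false) ∷ (J , true) ∷ []
    pair false = here refl
    pair true  = there (here refl)

  levelKey-just⁻ : ∀ {n m} (A : Hyp s n) {J} → levelKey m A ≡ just J →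
                   ∃[ H ] ∃[ a ] maxF s A ≡ suc m × projH s (suc m) A ≡ just (H , just a) × F s H ≡ J
  levelKey-just⁻ {m = m} A eq with maxF s A ℕ.≡ᵇ suc m in max≡ | projH s (suc m) A | eq
  ... | true | just (H , just a) | refl = H , a , ℕ.≡ᵇ⇒≡ _ _ (subst T (sym max≡) tt) , refl , refl

  levelKey-‖F‖ : ∀ {n m} (A : Hyp s n) {J} → levelKey m A ≡ just J → ‖_‖ s (F s A) ≡ ‖_‖ s J *ℕ s (suc m)
  levelKey-‖F‖ {m = m} A eq with H , a , max≡ , proj≡ , refl ← levelKey-just⁻ A eq = ‖F‖-projH (suc m) A proj≡ max≡

  levelKey-Parallel : ∀ {n m} (A A′ : Hyp s n) {J} → levelKey m A ≡ just J → levelKey m A′ ≡ just J → Parallel s A A′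
  levelKey-Parallel {m = m} A A′ eq eq′
    with H , _ , max≡ , proj≡ , refl ← levelKey-just⁻ A eq
       | H′ , _ , max≡′ , proj≡′ , F≡ ← levelKey-just⁻ A′ eq′
    = Parallel-projH (suc m) A A′ proj≡ proj≡′ max≡ max≡′ (cong (_, true) (sym F≡))

-- Weight systems

module _ (s : ℕ → ℕ) where

  mass : (k : ℕ) → (Q s k → ℚ) → (Q s k → Bool) → ℚ
  mass k W P = sumℚ (map (λ x → if P x then W x else 0ℚ) (allQ s k))

  mass-suc : ∀ k (W : Q s (suc k) → ℚ) (P : Q s (suc k) → Bool) →
             mass (suc k) W P ≡ sumℚ (map (λ x → sumℚ (map (λ y → if P (x , y) then W (x , y) else 0ℚ)
                                                              (allFin (s (suc k))))) (allQ s k))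
  mass-suc k W P = trans (sumℚ-concatMap _ (λ x → map (x ,_) (allFin (s (suc k)))) (allQ s k))
                         (cong sumℚ (map-cong (λ x → cong sumℚ (sym (map-∘ (allFin (s (suc k)))))) (allQ s k)))

  -- inB s [ A ] k is the indicator of B_k({A}), and B_k(𝒜) is the union of these.
  mass-inB-subadditive : ∀ {n} k (W : Q s k → ℚ) → (∀ x → 0ℚ ≤ W x) → (𝒜 : List (Hyp s n)) →
                         mass k W (inB s 𝒜 k) ≤ sumℚ (map (λ A → mass k W (inB s [ A ] k)) 𝒜)
  mass-inB-subadditive {n} k W 0≤W 𝒜 = begin
    mass k W (inB s 𝒜 k)
      ≤⟨ sumℚ-mono (allQ s k) (λ x → union x 𝒜) ⟩
    sumℚ (map (λ x → sumℚ (map (λ A → if inB s [ A ] k x then W x else 0ℚ) 𝒜)) (allQ s k))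
      ≡⟨ sumℚ-comm (λ x A → if inB s [ A ] k x then W x else 0ℚ) (allQ s k) 𝒜 ⟩
    sumℚ (map (λ A → mass k W (inB s [ A ] k)) 𝒜) ∎
    where
    open ≤-Reasoning
    if-∨ : ∀ x b c → (if b ∨ c then W x else 0ℚ) ≤ (if b ∨ false then W x else 0ℚ) + (if c then W x else 0ℚ)
    if-∨ x true  c     = ≤-trans (≤-reflexive (sym (+-identityʳ (W x)))) (+-monoʳ-≤ (W x) (if-nonNeg c))
      where
      if-nonNeg : ∀ c → 0ℚ ≤ (if c then W x else 0ℚ)
      if-nonNeg true  = 0≤W x
      if-nonNeg false = ≤-refl
    if-∨ x false true  = ≤-reflexive (sym (+-identityˡ (W x)))
    if-∨ x false false = ≤-refl
    union : ∀ x (ℬ : List (Hyp s n)) →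
            (if inB s ℬ k x then W x else 0ℚ) ≤ sumℚ (map (λ A → if inB s [ A ] k x then W x else 0ℚ) ℬ)
    union x []      = ≤-refl
    union x (A ∷ ℬ) = ≤-trans (if-∨ x _ (inB s ℬ k x)) (+-monoʳ-≤ (if inB s [ A ] k x then W x else 0ℚ) (union x ℬ))


κ : (s : ℕ → ℕ) (δ : ℕ → ℚ) → ℕ → ℚ
κ s δ k = 1ℚ ÷' ((1ℚ - δ k) * ⟦ s k ⟧)

κ-nonNeg : (s : ℕ → ℕ) (δ : ℕ → ℚ) → ∀ k → δ k ≤ 1ℚ → 0ℚ ≤ κ s δ k
κ-nonNeg s δ k δ≤1 = ÷'-nonNeg 0≤1 (*-nonNeg (p≤q⇒0≤q-p δ≤1) (⟦⟧-nonNeg (s k)))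

module MassSplitting (s : ℕ → ℕ) (δ : ℕ → ℚ) (0≤κ : ∀ k → 0ℚ ≤ κ s δ (suc k))
  (W : (k : ℕ) → Q s k → ℚ)
  (W-root : W zero tt ≡ 1ℚ)
  (W-split : ∀ k x → sumℚ (map (λ y → W (suc k) (x , y)) (allFin (s (suc k)))) ≡ W k x)
  (W-nonNeg : ∀ k x → 0ℚ ≤ W k x)
  (W-step : ∀ k x y → W (suc k) (x , y) ≤ κ s δ (suc k) * W k x) where

  mass-hyperplane≤ν : ∀ k (H : Hyp s k) → mass s k (W k) (memb s H) ≤ ν s δ (F s H)
  mass-hyperplane≤ν zero    tt           = ≤-reflexive (trans (+-identityʳ _) W-root)
  mass-hyperplane≤ν (suc k) (H , nothing) = begin
    mass s (suc k) (W (suc k)) (memb s (H , nothing)) ≡⟨ mass-suc s k (W (suc k)) (memb s (H , nothing)) ⟩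
    sumℚ (map (λ x → sumℚ (map (λ y → if memb s H x then W (suc k) (x , y) else 0ℚ) Sₖ)) (allQ s k))
      ≡⟨ cong sumℚ (map-cong fibre (allQ s k)) ⟩
    mass s k (W k) (memb s H)                           ≤⟨ mass-hyperplane≤ν k H ⟩
    ν s δ (F s H)                                       ∎
    where
    open ≤-Reasoning
    Sₖ = allFin (s (suc k))
    fibre : ∀ x → sumℚ (map (λ y → if memb s H x then W (suc k) (x , y) else 0ℚ) Sₖ)
                  ≡ (if memb s H x then W k x else 0ℚ)
    fibre x with memb s H x
    ... | true  = W-split k x
    ... | false = sumℚ-map-0 Sₖ
  mass-hyperplane≤ν (suc k) (H , just a) = begin
    mass s (suc k) (W (suc k)) (memb s (H , just a)) ≡⟨ mass-suc s k (W (suc k)) (memb s (H , just a)) ⟩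
    sumℚ (map (λ x → sumℚ (map (λ y → if (toℕ a ℕ.≡ᵇ toℕ y) ∧ memb s H x then W (suc k) (x , y) else 0ℚ) Sₖ))
              (allQ s k))                          ≤⟨ sumℚ-mono (allQ s k) fibre ⟩
    sumℚ (map (λ x → c * (if memb s H x then W k x else 0ℚ)) (allQ s k))
      ≡⟨ *-distribˡ-sumℚ c _ (allQ s k) ⟨
    c * mass s k (W k) (memb s H)                  ≤⟨ *-monoˡ-≤-nonNeg c {{nonNegative (0≤κ k)}} (mass-hyperplane≤ν k H) ⟩
    c * ν s δ (F s H)                              ≡⟨ *-comm c _ ⟩
    ν s δ (F s H) * c                              ∎
    where
    open ≤-Reasoning
    Sₖ = allFin (s (suc k))
    c = κ s δ (suc k)
    point : ∀ x y → (if (toℕ a ℕ.≡ᵇ toℕ y) ∧ memb s H x then W (suc k) (x , y) else 0ℚ)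
                    ≤ (if toℕ a ℕ.≡ᵇ toℕ y then c * (if memb s H x then W k x else 0ℚ) else 0ℚ)
    point x y with toℕ a ℕ.≡ᵇ toℕ y | memb s H x
    ... | true  | true  = W-step k x y
    ... | true  | false = ≤-reflexive (sym (*-zeroʳ c))
    ... | false | _     = ≤-refl
    fibre : ∀ x → sumℚ (map (λ y → if (toℕ a ℕ.≡ᵇ toℕ y) ∧ memb s H x then W (suc k) (x , y) else 0ℚ) Sₖ)
                  ≤ c * (if memb s H x then W k x else 0ℚ)
    fibre x = ≤-trans (sumℚ-mono Sₖ (point x)) (≤-reflexive (sumℚ-indicator-allFin a _))

  ν-nonNeg : ∀ {k} (J : Sub s k) → 0ℚ ≤ ν s δ J
  ν-nonNeg {zero}  tt          = 0≤1
  ν-nonNeg {suc k} (J , false) = ν-nonNeg J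
  ν-nonNeg {suc k} (J , true)  = *-nonNeg (ν-nonNeg J) (0≤κ k)

  mass-inB-singleton : ∀ {n} m (A : Hyp s n) →
    mass s (suc m) (W (suc m)) (inB s [ A ] (suc m)) ≤ maybe′ (λ J → ν s δ (J , true)) 0ℚ (levelKey s m A)
  mass-inB-singleton m A with maxF s A ℕ.≡ᵇ suc m in max≡ | projH s (suc m) A in proj≡
  ... | false | _                  = ≤-reflexive (sumℚ-map-0 (allQ s (suc m)))
  ... | true  | nothing            = ≤-reflexive (sumℚ-map-0 (allQ s (suc m)))
  ... | true  | just (H , nothing) = ⊥-elim (ℕ.<-irrefl refl (ℕ.≤-<-trans (maxF≤ s H) (ℕ.≤-reflexive (sym maxH≡))))
    where maxH≡ = maxF-projH s (suc m) A proj≡ (ℕ.≡ᵇ⇒≡ _ _ (subst T (sym max≡) tt))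
  ... | true  | just (H , just a)  = begin
    sumℚ (map (λ x → if memb s (H , just a) x ∨ false then W (suc m) x else 0ℚ) (allQ s (suc m)))
      ≡⟨ cong sumℚ (map-cong (λ x → cong (if_then W (suc m) x else 0ℚ) (∨-identityʳ _)) (allQ s (suc m))) ⟩
    mass s (suc m) (W (suc m)) (memb s (H , just a)) ≤⟨ mass-hyperplane≤ν (suc m) (H , just a) ⟩
    ν s δ (F s H , true) ∎
    where open ≤-Reasoning

  mass-inB-bound : ∀ {n} (𝒜 : List (Hyp s n)) (C₀ : ℚ) →
    AllPairs (λ A A′ → ¬ Parallel s A A′) 𝒜 → (∀ A → A ∈ 𝒜 → C₀ < ⟦ ‖_‖ s (F s A) ⟧) → ∀ m →
    mass s (suc m) (W (suc m)) (inB s 𝒜 (suc m))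
      ≤ κ s δ (suc m) * sumℚ (map (ν s δ) (filter (λ J → C₀ <? ⟦ ‖_‖ s J *ℕ s (suc m) ⟧) (allSub s m)))
  mass-inB-bound 𝒜 C₀ non-parallel large m = begin
    mass s (suc m) (W (suc m)) (inB s 𝒜 (suc m))
      ≤⟨ mass-inB-subadditive s (suc m) (W (suc m)) (W-nonNeg (suc m)) 𝒜 ⟩
    sumℚ (map (λ A → mass s (suc m) (W (suc m)) (inB s [ A ] (suc m))) 𝒜)
      ≤⟨ sumℚ-mono 𝒜 (mass-inB-singleton m) ⟩
    sumℚ (map (λ A → maybe′ f 0ℚ (levelKey s m A)) 𝒜)
      ≡⟨ sumℚ-maybe′ f (levelKey s m) 𝒜 ⟩
    sumℚ (map f (mapMaybe (levelKey s m) 𝒜))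
      ≤⟨ sumℚ-mono-⊆ (λ J → ν-nonNeg (J , true)) keys-unique keys⊆large ⟩
    sumℚ (map f large-subsets)
      ≡⟨ cong sumℚ (map-cong (λ J → *-comm (ν s δ J) c) large-subsets) ⟩
    sumℚ (map (λ J → c * ν s δ J) large-subsets)
      ≡⟨ *-distribˡ-sumℚ c (ν s δ) large-subsets ⟨
    c * sumℚ (map (ν s δ) large-subsets) ∎
    where
    open ≤-Reasoning
    c = κ s δ (suc m)
    f = λ J → ν s δ (J , true)
    large? = λ J → C₀ <? ⟦ ‖_‖ s J *ℕ s (suc m) ⟧
    large-subsets = filter large? (allSub s m)
    keys-unique : Unique (mapMaybe (levelKey s m) 𝒜)
    keys-unique = Unique-mapMaybe (levelKey s m)
      (AllPairs.map (λ {A} {A′} ¬par {J} eq eq′ → ¬par (levelKey-Parallel s A A′ eq eq′)) non-parallel)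
    keys⊆large : mapMaybe (levelKey s m) 𝒜 ⊆ large-subsets
    keys⊆large J∈ with A , A∈𝒜 , key≡ ← ∈-mapMaybe⁻ (levelKey s m) J∈ =
      ∈-filter⁺ large? (allSub-complete s m _) (subst (λ z → C₀ < ⟦ z ⟧) (levelKey-‖F‖ s A key≡) (large A A∈𝒜))

-- The weights w_k

module Weights (s : ℕ → ℕ) (s-pos : ∀ k → 0 ℕ.< s (suc k))
         (δ : ℕ → ℚ) (δ-range : ∀ k → 0ℚ ≤ δ (suc k) × δ (suc k) < 1ℚ)
         {n : ℕ} (𝒜 : List (Hyp s n)) where

  private
    0<N : ∀ k → 0ℚ < ⟦ s (suc k) ⟧
    0<N k = ⟦⟧-pos (s-pos k)

  w-suc : ∀ k x y → w s δ 𝒜 (suc k) (x , y)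
                    ≡ splitFactor (α s δ 𝒜 k x) (δ (suc k)) (inB s 𝒜 (suc k) (x , y)) * (w s δ 𝒜 k x ÷' ⟦ s (suc k) ⟧)
  w-suc k x y = factor-out (α s δ 𝒜 k x ≤ᵇ δ (suc k)) (inB s 𝒜 (suc k) (x , y))
    where
    factor-out : ∀ c b {u v t base : ℚ} →
                 (if c then (if b then 0ℚ else u * base) else (if b then v * base else t * base))
                   ≡ (if c then (if b then 0ℚ else u) else (if b then v else t)) * base
    factor-out true  true  {base = base} = sym (*-zeroˡ base)
    factor-out true  false = refl
    factor-out false true  = refl
    factor-out false false = refl

  w-nonNeg : ∀ k x → 0ℚ ≤ w s δ 𝒜 k x
  w-nonNeg zero    tt      = 0≤1
  w-nonNeg (suc k) (x , y) = subst (0ℚ ≤_) (sym (w-suc k x y))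
    (*-nonNeg (splitFactor-nonNeg {a = α s δ 𝒜 k x} (proj₁ (δ-range k)) (proj₂ (δ-range k)) (inB s 𝒜 (suc k) (x , y)))
              (÷'-nonNeg (w-nonNeg k x) (⟦⟧-nonNeg (s (suc k)))))

  w-step : ∀ k x y → w s δ 𝒜 (suc k) (x , y) ≤ κ s δ (suc k) * w s δ 𝒜 k x
  w-step k x y = subst (_≤ κ s δ (suc k) * w s δ 𝒜 k x) (sym (w-suc k x y))
    (splitFactor-step (proj₁ (δ-range k)) (proj₂ (δ-range k)) (0<N k) (α s δ 𝒜 k x) (inB s 𝒜 (suc k) (x , y)) (w-nonNeg k x))

  w-split : ∀ k x → sumℚ (map (λ y → w s δ 𝒜 (suc k) (x , y)) (allFin (s (suc k)))) ≡ w s δ 𝒜 k x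
  w-split k x = trans (cong sumℚ (map-cong (w-suc k x) (allFin (s (suc k)))))
    (splitFactor-sum (proj₁ (δ-range k)) (proj₂ (δ-range k)) (0<N k) (λ y → inB s 𝒜 (suc k) (x , y))
                     (allFin (s (suc k))) (cong ⟦_⟧ (length-tabulate {n = s (suc k)} id)))

corollary1 : (s : ℕ → ℕ) → (∀ j → 1 ≤ℕ j → 2 ≤ℕ s j)
    → (n : ℕ) → (δ : ℕ → ℚ) → (∀ j → 0ℚ ≤ δ j × δ j ≤ ½)
    → (C₀ : ℚ) → (𝒜 : List (Hyp s n))
    → AllPairs (λ A A' → ¬ Parallel s A A') 𝒜
    → (∀ A → A ∈ 𝒜 → C₀ < ⟦ ‖_‖ s (F s A) ⟧)
    → (k : ℕ) → 1 ≤ℕ k → k ≤ℕ n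
    → wB s δ 𝒜 k ≤
        ((1ℚ ÷' ((1ℚ - δ k) * ⟦ s k ⟧))
          * sumℚ (map (ν s δ) (filter (λ J → C₀ <? ⟦ ‖_‖ s J *ℕ s k ⟧) (allSub s (k ∸ 1)))))
corollary1 s s≥2 n δ δ∈[0,½] C₀ 𝒜 non-parallel large (suc m) _ _ =
  mass-inB-bound 𝒜 C₀ non-parallel large m
  where
  s-pos : ∀ k → 0 ℕ.< s (suc k)
  s-pos k = ℕ.<-≤-trans (s≤s z≤n) (s≥2 (suc k) (s≤s z≤n))
  δ<1 : ∀ k → δ k < 1ℚ
  δ<1 k = ≤-<-trans (proj₂ (δ∈[0,½] k)) ½<1
  open Weights s s-pos δ (λ k → proj₁ (δ∈[0,½] (suc k)) , δ<1 (suc k)) 𝒜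
  open MassSplitting s δ (λ k → κ-nonNeg s δ (suc k) (<⇒≤ (δ<1 (suc k)))) (w s δ 𝒜) refl w-split w-nonNeg w-step
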